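{- Let $n>2$ be an integer, let $k$ be an odd integer with $1<k<2^{n}$, and let $r$ be the non-negative integer with $2^r<k<2^{r+1}$. Then $\{k2^{n+i}+1\mid i=0,1,\dots,n+r\}$ is the minimal system of generators of the numerical semigroup $P_k(n)=\langle\{k2^{n+i}+1\mid i\in\mathbb{N}\}\rangle$, and hence the embedding dimension of $P_k(n)$ is $\mathrm{e}(P_k(n))=n+r+1$.
   Context: $\mathbb{N}$ denotes the non-negative integers; $\langle A\rangle$ is the set of finite $\mathbb{N}$-linear combinations of elements of $A$. A system of generators $B$ of a numerical semigroup $S$ (i.e. $S=\langle B\rangle$) is minimal if no proper subset of $B$ generates $S$; every numerical semigroup has a unique finite minimal system of generators, and its cardinality is the embedding dimension $\mathrm{e}(S)$. -}

module Defs where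

open import Level using (0ℓ)
open import Data.Nat using (ℕ; zero; suc; _+_; _*_; _^_; _≤_; _<_)
open import Data.Fin using (Fin)
open import Data.Product using (Σ; ∃; _×_; _,_)
open import Relation.Unary using (Pred; _⊆_)
open import Relation.Nullary using (¬_)
open import Relation.Binary.PropositionalEquality using (_≡_)
open import Function.Definitions using (Injective)

data ⟨_⟩ (A : Pred ℕ 0ℓ) : Pred ℕ 0ℓ where
  ⟨⟩-zero : ⟨ A ⟩ 0
  ⟨⟩-add  : ∀ {a x} → A a → ⟨ A ⟩ x → ⟨ A ⟩ (a + x)

_≐_ : Pred ℕ 0ℓ → Pred ℕ 0ℓ → Set
A ≐ B = (A ⊆ B) × (B ⊆ A)

Generates : Pred ℕ 0ℓ → Pred ℕ 0ℓ → Set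
Generates B S = ⟨ B ⟩ ≐ S

IsMinimalSystemOfGenerators : Pred ℕ 0ℓ → Pred ℕ 0ℓ → Set₁
IsMinimalSystemOfGenerators B S =
  Generates B S ×
  ((C : Pred ℕ 0ℓ) → C ⊆ B → (∃ λ b → B b × ¬ C b) → ¬ Generates C S)

Image : ∀ {e} → (Fin e → ℕ) → Pred ℕ 0ℓ
Image {e} f x = Σ (Fin e) λ j → f j ≡ x

EmbeddingDimension : Pred ℕ 0ℓ → ℕ → Set₁
EmbeddingDimension S e =
  Σ (Fin e → ℕ) λ f → Injective _≡_ _≡_ f × IsMinimalSystemOfGenerators (Image f) S

P-gen : ℕ → ℕ → Pred ℕ 0ℓ
P-gen k n x = ∃ λ i → x ≡ k * 2 ^ (n + i) + 1

P : ℕ → ℕ → Pred ℕ 0ℓ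
P k n = ⟨ P-gen k n ⟩

B-gen : ℕ → ℕ → ℕ → Pred ℕ 0ℓ
B-gen k n r x = ∃ λ i → i ≤ n + r × x ≡ k * 2 ^ (n + i) + 1

-- Write K = k 2ⁿ, R = n + r and gᵢ = K 2ⁱ + 1, so that g_{i+1} + 1 = 2 gᵢ.
-- A sum of s generators g_{i₁}, …, g_{iₛ} equals K (2^{i₁} + ⋯ + 2^{iₛ}) + s.
--
-- Generation: splitting 2^{R+1} − 1 = 1 + 2 + ⋯ + 2^R further into K + 1 powers
-- 2ⁱ with i ≤ R (possible since R + 1 ≤ K + 1 ≤ 2^{R+1} − 1) writes g_{R+1} as a
-- sum of K + 1 of the generators g₀, …, g_R.  Beyond that, if g_N = gⱼ + y then
-- g_{N+1} = g_{j+1} + 2y, so every g_N lies in ⟨g₀, …, g_R⟩.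
--
-- Minimality: if gᵢ (i ≤ R) were a sum K A + s of s ≥ 2 generators, then either
-- s ≤ K, and s ≡ 1 modulo K is impossible, or s > K, and then A ≥ s > K makes the
-- sum exceed K (K + 1) + 1 ≥ K 2^R + 1 ≥ gᵢ.
module Submission where

open import Level using (0ℓ)
open import Data.Nat using (ℕ; zero; suc; _+_; _*_; _^_; _∸_; _≤_; _<_; _%_; z≤n; s≤s; s<s; s≤s⁻¹; >-nonZero)
open import Data.Nat.Properties
open import Data.Nat.Tactic.RingSolver using (solve-∀)
open import Data.Fin using (Fin; toℕ; fromℕ<)
open import Data.Fin.Properties using (toℕ<n; toℕ-fromℕ<; toℕ-injective)
open import Data.Product using (∃; ∃₂; _×_; _,_)
open import Data.Sum using (inj₁; inj₂)
open import Data.Empty using (⊥-elim)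
open import Function.Definitions using (Injective)
open import Relation.Nullary using (yes; no; contradiction)
open import Relation.Unary using (Pred; _⊆_)
open import Relation.Binary.PropositionalEquality
open import Algebra.Properties.CommutativeSemigroup +-commutativeSemigroup using (interchange; xy∙z≈xz∙y)

open import Defs

⟨⟩-singleton : ∀ {A : Pred ℕ 0ℓ} {a} → A a → ⟨ A ⟩ a
⟨⟩-singleton {a = a} Aa = subst ⟨ _ ⟩ (+-identityʳ a) (⟨⟩-add Aa ⟨⟩-zero)

⟨⟩-+ : ∀ {A : Pred ℕ 0ℓ} {x y} → ⟨ A ⟩ x → ⟨ A ⟩ y → ⟨ A ⟩ (x + y)
⟨⟩-+ ⟨⟩-zero q = q
⟨⟩-+ {y = y} (⟨⟩-add {a} {x} Aa p) q = subst ⟨ _ ⟩ (sym (+-assoc a x y)) (⟨⟩-add Aa (⟨⟩-+ p q))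

⟨⟩-least : ∀ {A B : Pred ℕ 0ℓ} → A ⊆ ⟨ B ⟩ → ⟨ A ⟩ ⊆ ⟨ B ⟩
⟨⟩-least A⊆⟨B⟩ ⟨⟩-zero = ⟨⟩-zero
⟨⟩-least A⊆⟨B⟩ (⟨⟩-add Aa p) = ⟨⟩-+ (A⊆⟨B⟩ Aa) (⟨⟩-least A⊆⟨B⟩ p)

⟨⟩-mono : ∀ {A B : Pred ℕ 0ℓ} → A ⊆ B → ⟨ A ⟩ ⊆ ⟨ B ⟩
⟨⟩-mono A⊆B ⟨⟩-zero = ⟨⟩-zero
⟨⟩-mono A⊆B (⟨⟩-add Aa p) = ⟨⟩-add (A⊆B Aa) (⟨⟩-mono A⊆B p)

summands : ∀ {A : Pred ℕ 0ℓ} {x} → ⟨ A ⟩ x → ℕ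
summands ⟨⟩-zero = 0
summands (⟨⟩-add _ p) = suc (summands p)

summands-⟨⟩-mono : ∀ {A B : Pred ℕ 0ℓ} {x} (A⊆B : A ⊆ B) (p : ⟨ A ⟩ x) →
  summands (⟨⟩-mono A⊆B p) ≡ summands p
summands-⟨⟩-mono A⊆B ⟨⟩-zero = refl
summands-⟨⟩-mono A⊆B (⟨⟩-add _ p) = cong suc (summands-⟨⟩-mono A⊆B p)

summands≡1⇒∈ : ∀ {A : Pred ℕ 0ℓ} {x} (p : ⟨ A ⟩ x) → summands p ≡ 1 → A x
summands≡1⇒∈ {A} (⟨⟩-add {a} Aa ⟨⟩-zero) refl = subst A (sym (+-identityʳ a)) Aa

IsMinimalSystemOfGenerators-resp-≐ : ∀ {A A′ S : Pred ℕ 0ℓ} → A ≐ A′ →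
  IsMinimalSystemOfGenerators A S → IsMinimalSystemOfGenerators A′ S
IsMinimalSystemOfGenerators-resp-≐ (A⊆A′ , A′⊆A) ((⟨A⟩⊆S , S⊆⟨A⟩) , minimal) =
  ((λ p → ⟨A⟩⊆S (⟨⟩-mono A′⊆A p)) , (λ p → ⟨⟩-mono A⊆A′ (S⊆⟨A⟩ p))) ,
  λ C C⊆A′ (b , A′b , ¬Cb) → minimal C (λ Cc → A′⊆A (C⊆A′ Cc)) (b , A′⊆A A′b , ¬Cb)

-- A representation of b ∈ B by elements of C ⊆ B is one by elements of B, so it is
-- b alone, and b ∈ C.
irreducible⇒minimal : ∀ {B S : Pred ℕ 0ℓ} → Generates B S →
  (∀ {b} → B b → (p : ⟨ B ⟩ b) → summands p ≡ 1) → IsMinimalSystemOfGenerators B S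
irreducible⇒minimal (⟨B⟩⊆S , S⊆⟨B⟩) irreducible =
  (⟨B⟩⊆S , S⊆⟨B⟩) , λ C C⊆B (b , Bb , ¬Cb) (_ , S⊆⟨C⟩) →
    let p = S⊆⟨C⟩ (⟨B⟩⊆S (⟨⟩-singleton Bb)) in
    ¬Cb (summands≡1⇒∈ p (trans (sym (summands-⟨⟩-mono C⊆B p)) (irreducible Bb (⟨⟩-mono C⊆B p))))

split-sum : ∀ {l₁ h₁ l₂ h₂ t} → l₁ ≤ h₁ → l₂ ≤ h₂ → l₁ + l₂ ≤ t → t ≤ h₁ + h₂ →
  ∃₂ λ t₁ t₂ → (l₁ ≤ t₁ × t₁ ≤ h₁) × (l₂ ≤ t₂ × t₂ ≤ h₂) × t₁ + t₂ ≡ t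
split-sum {l₁} {h₁} {l₂} {h₂} {t} l₁≤h₁ l₂≤h₂ lo hi with t ≤? h₁ + l₂
... | yes t≤h₁+l₂ =
  t ∸ l₂ , l₂ ,
  (m+n≤o⇒m≤o∸n l₁ lo , m≤n+o⇒m∸n≤o t l₂ (subst (t ≤_) (+-comm h₁ l₂) t≤h₁+l₂)) ,
  (≤-refl , l₂≤h₂) ,
  m∸n+n≡m (m+n≤o⇒n≤o l₁ lo)
... | no t≰h₁+l₂ =
  h₁ , t ∸ h₁ ,
  (l₁≤h₁ , ≤-refl) ,
  (m+n≤o⇒m≤o∸n l₂ (subst (_≤ t) (+-comm h₁ l₂) h₁+l₂≤t) , m≤n+o⇒m∸n≤o t h₁ hi) ,
  m+[n∸m]≡n (m+n≤o⇒m≤o h₁ h₁+l₂≤t)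
  where
  h₁+l₂≤t : h₁ + l₂ ≤ t
  h₁+l₂≤t = <⇒≤ (≰⇒> t≰h₁+l₂)

*-+-residue-unique : ∀ K A B {s t} → 0 < s → s ≤ K → 0 < t → t ≤ K →
  K * A + s ≡ K * B + t → s ≡ t
*-+-residue-unique K zero zero _ _ _ _ eq = +-cancelˡ-≡ (K * 0) _ _ eq
*-+-residue-unique K zero (suc B) {s} {t} _ s≤K 0<t _ eq =
  contradiction (subst (_≤ K) s≡ s≤K) (<⇒≱ K<K*[1+B]+t)
  where
  s≡ : s ≡ K * suc B + t
  s≡ = trans (cong (_+ s) (sym (*-zeroʳ K))) eq
  K<K*[1+B]+t : K < K * suc B + t
  K<K*[1+B]+t = <-≤-trans (m<m+n K 0<t) (+-monoˡ-≤ t (m≤m*n K (suc B)))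
*-+-residue-unique K (suc A) zero 0<s s≤K 0<t t≤K eq =
  sym (*-+-residue-unique K zero (suc A) 0<t t≤K 0<s s≤K (sym eq))
*-+-residue-unique K (suc A) (suc B) {s} {t} 0<s s≤K 0<t t≤K eq =
  *-+-residue-unique K A B 0<s s≤K 0<t t≤K
    (+-cancelˡ-≡ K _ _ (trans (sym (*-suc-+ A s)) (trans eq (*-suc-+ B t))))
  where
  *-suc-+ : ∀ C u → K * suc C + u ≡ K + (K * C + u)
  *-suc-+ C u = trans (cong (_+ u) (*-suc K C)) (+-assoc K (K * C) u)

2^-suc : ∀ m → 2 ^ suc m ≡ 2 ^ m + 2 ^ m
2^-suc m = cong (2 ^ m +_) (+-identityʳ (2 ^ m))

n<2^n : ∀ n → n < 2 ^ n
n<2^n zero = s≤s z≤n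
n<2^n (suc n) = begin-strict
  suc n          <⟨ s<s (n<2^n n) ⟩
  1 + 2 ^ n      ≤⟨ +-monoˡ-≤ (2 ^ n) (m^n>0 2 n) ⟩
  2 ^ n + 2 ^ n  ≡⟨ 2^-suc n ⟨
  2 ^ suc n      ∎
  where open ≤-Reasoning

^-injectiveʳ : ∀ m {a b} → 1 < m → m ^ a ≡ m ^ b → a ≡ b
^-injectiveʳ m 1<m eq = ≤-antisym
  (≮⇒≥ λ b<a → <-irrefl (sym eq) (^-monoʳ-< m 1<m b<a))
  (≮⇒≥ λ a<b → <-irrefl eq (^-monoʳ-< m 1<m a<b))

ones : ℕ → ℕ
ones zero = 1
ones (suc j) = 2 ^ suc j + ones j

1+ones≡2^[1+j] : ∀ j → suc (ones j) ≡ 2 ^ suc j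
1+ones≡2^[1+j] zero = refl
1+ones≡2^[1+j] (suc j) = begin
  suc (2 ^ suc j + ones j)  ≡⟨ +-suc (2 ^ suc j) (ones j) ⟨
  2 ^ suc j + suc (ones j)  ≡⟨ cong (2 ^ suc j +_) (1+ones≡2^[1+j] j) ⟩
  2 ^ suc j + 2 ^ suc j     ≡⟨ 2^-suc (suc j) ⟨
  2 ^ suc (suc j)           ∎
  where open ≡-Reasoning

1+j≤ones : ∀ j → suc j ≤ ones j
1+j≤ones zero = ≤-refl
1+j≤ones (suc j) = +-mono-≤ (m^n>0 2 (suc j)) (1+j≤ones j)

module PowerGenerators (K R : ℕ) where

  gen : ℕ → ℕ
  gen i = K * 2 ^ i + 1

  G : Pred ℕ 0ℓ
  G x = ∃ λ i → i ≤ R × x ≡ gen i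

  gen∈⟨G⟩-≤R : ∀ {i} → i ≤ R → ⟨ G ⟩ (gen i)
  gen∈⟨G⟩-≤R i≤R = ⟨⟩-singleton (_ , i≤R , refl)

  gen-suc : ∀ i → gen (suc i) + 1 ≡ gen i + gen i
  gen-suc i = identity K (2 ^ i)
    where
    identity : ∀ K P → K * (2 * P) + 1 + 1 ≡ (K * P + 1) + (K * P + 1)
    identity = solve-∀

  gen-doubling : ∀ j {y} N → gen j + y ≡ gen N → gen (suc j) + (y + y) ≡ gen (suc N)
  gen-doubling j {y} N eq = +-cancelʳ-≡ 1 _ _ (begin
    gen (suc j) + (y + y) + 1      ≡⟨ xy∙z≈xz∙y (gen (suc j)) (y + y) 1 ⟩
    gen (suc j) + 1 + (y + y)      ≡⟨ cong (_+ (y + y)) (gen-suc j) ⟩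
    gen j + gen j + (y + y)        ≡⟨ interchange (gen j) (gen j) y y ⟩
    (gen j + y) + (gen j + y)      ≡⟨ cong₂ _+_ eq eq ⟩
    gen N + gen N                  ≡⟨ sym (gen-suc N) ⟩
    gen (suc N) + 1                ∎)
    where open ≡-Reasoning

  0≢gen : ∀ i → 0 ≢ gen i
  0≢gen i 0≡gen = 0≢1+n (trans 0≡gen (+-comm (K * 2 ^ i) 1))

  K*2^m+t∈⟨G⟩ : ∀ {m t} → m ≤ R → 0 < t → t ≤ 2 ^ m → ⟨ G ⟩ (K * 2 ^ m + t)
  K*2^m+t∈⟨G⟩ {m} {suc zero} m≤R _ _ = gen∈⟨G⟩-≤R m≤R
  K*2^m+t∈⟨G⟩ {zero} {suc (suc _)} _ _ (s≤s ())
  K*2^m+t∈⟨G⟩ {suc m} {t@(suc (suc _))} 1+m≤R _ t≤2^[1+m]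
    with split-sum (m^n>0 2 m) (m^n>0 2 m) (s≤s (s≤s z≤n)) (subst (t ≤_) (2^-suc m) t≤2^[1+m])
  ... | t₁ , t₂ , (0<t₁ , t₁≤2^m) , (0<t₂ , t₂≤2^m) , t₁+t₂≡t =
    subst ⟨ G ⟩ (trans (identity K (2 ^ m) t₁ t₂) (cong (K * 2 ^ suc m +_) t₁+t₂≡t))
      (⟨⟩-+ (K*2^m+t∈⟨G⟩ m≤R 0<t₁ t₁≤2^m) (K*2^m+t∈⟨G⟩ m≤R 0<t₂ t₂≤2^m))
    where
    m≤R : m ≤ R
    m≤R = ≤-trans (n≤1+n m) 1+m≤R
    identity : ∀ K P a b → (K * P + a) + (K * P + b) ≡ K * (2 * P) + (a + b)
    identity = solve-∀

  K*ones+t∈⟨G⟩ : ∀ {j t} → j ≤ R → suc j ≤ t → t ≤ ones j → ⟨ G ⟩ (K * ones j + t)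
  K*ones+t∈⟨G⟩ {zero} {suc zero} _ _ _ = gen∈⟨G⟩-≤R z≤n
  K*ones+t∈⟨G⟩ {zero} {suc (suc _)} _ _ (s≤s ())
  K*ones+t∈⟨G⟩ {suc j} 1+j≤R lo hi
    with split-sum (m^n>0 2 (suc j)) (1+j≤ones j) lo hi
  ... | t₁ , t₂ , (0<t₁ , t₁≤2^[1+j]) , (1+j≤t₂ , t₂≤ones) , t₁+t₂≡t =
    subst ⟨ G ⟩ (trans (identity K (2 ^ suc j) (ones j) t₁ t₂) (cong (K * ones (suc j) +_) t₁+t₂≡t))
      (⟨⟩-+ (K*2^m+t∈⟨G⟩ 1+j≤R 0<t₁ t₁≤2^[1+j])
            (K*ones+t∈⟨G⟩ (≤-trans (n≤1+n j) 1+j≤R) 1+j≤t₂ t₂≤ones))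
    where
    identity : ∀ K P Q a b → (K * P + a) + (K * Q + b) ≡ K * (P + Q) + (a + b)
    identity = solve-∀

  module _ (R≤K : R ≤ K) (1+K<2^[1+R] : suc K < 2 ^ suc R) where

    gen[1+R]∈⟨G⟩ : ⟨ G ⟩ (gen (suc R))
    gen[1+R]∈⟨G⟩ = subst ⟨ G ⟩ (trans (identity K (ones R)) (cong (λ D → K * D + 1) (1+ones≡2^[1+j] R)))
      (K*ones+t∈⟨G⟩ ≤-refl (s≤s R≤K) (s≤s⁻¹ (subst (suc K <_) (sym (1+ones≡2^[1+j] R)) 1+K<2^[1+R])))
      where
      identity : ∀ K D → K * D + suc K ≡ K * suc D + 1
      identity = solve-∀

    gen-suc∈⟨G⟩ : ∀ {i} → i ≤ R → ⟨ G ⟩ (gen (suc i))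
    gen-suc∈⟨G⟩ i≤R with m≤n⇒m<n∨m≡n i≤R
    ... | inj₁ i<R = gen∈⟨G⟩-≤R i<R
    ... | inj₂ refl = gen[1+R]∈⟨G⟩

    gen∈⟨G⟩ : ∀ N → ⟨ G ⟩ (gen N)
    gen∈⟨G⟩ zero = gen∈⟨G⟩-≤R z≤n
    gen∈⟨G⟩ (suc N) = double (gen∈⟨G⟩ N) refl
      where
      double : ∀ {x} → ⟨ G ⟩ x → x ≡ gen N → ⟨ G ⟩ (gen (suc N))
      double ⟨⟩-zero 0≡gen = contradiction 0≡gen (0≢gen N)
      double (⟨⟩-add (j , j≤R , refl) p) eq =
        subst ⟨ G ⟩ (gen-doubling j N eq) (⟨⟩-+ (gen-suc∈⟨G⟩ j≤R) (⟨⟩-+ p p))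

  sum-shape : ∀ {x} (p : ⟨ G ⟩ x) → ∃ λ A → summands p ≤ A × x ≡ K * A + summands p
  sum-shape ⟨⟩-zero = 0 , z≤n , sym (trans (+-identityʳ (K * 0)) (*-zeroʳ K))
  sum-shape (⟨⟩-add (i , _ , refl) p) with sum-shape p
  ... | A , s≤A , x≡KA+s =
    2 ^ i + A , +-mono-≤ (m^n>0 2 i) s≤A ,
    trans (cong (gen i +_) x≡KA+s) (identity K (2 ^ i) A (summands p))
    where
    identity : ∀ K P A s → K * P + 1 + (K * A + s) ≡ K * (P + A) + suc s
    identity = solve-∀

  gen≢long-sum : ∀ {P A s} → P ≤ suc K → 2 ≤ s → s ≤ A → K * P + 1 ≢ K * A + s
  gen≢long-sum {P} {A} {s} P≤1+K 2≤s s≤A eq with s ≤? K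
  ... | yes s≤K = contradiction (subst (2 ≤_) (sym 1≡s) 2≤s) λ { (s≤s ()) }
    where
    1≡s : 1 ≡ s
    1≡s = *-+-residue-unique K P A (s≤s z≤n) (≤-trans (n≤1+n 1) (≤-trans 2≤s s≤K)) (≤-trans (n≤1+n 1) 2≤s) s≤K eq
  ... | no s≰K = <⇒≢ gen<long-sum eq
    where
    open ≤-Reasoning
    gen<long-sum : K * P + 1 < K * A + s
    gen<long-sum = begin-strict
      K * P + 1        ≤⟨ +-monoˡ-≤ 1 (*-monoʳ-≤ K P≤1+K) ⟩
      K * suc K + 1    <⟨ +-monoʳ-< (K * suc K) (n<1+n 1) ⟩
      K * suc K + 2    ≤⟨ +-mono-≤ (*-monoʳ-≤ K (≤-trans (≰⇒> s≰K) s≤A)) 2≤s ⟩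
      K * A + s        ∎

  G-irreducible : 2 ^ R ≤ suc K → ∀ {b} → G b → (p : ⟨ G ⟩ b) → summands p ≡ 1
  G-irreducible _ (i , _ , 0≡gen) ⟨⟩-zero = contradiction 0≡gen (0≢gen i)
  G-irreducible _ _ (⟨⟩-add _ ⟨⟩-zero) = refl
  G-irreducible 2^R≤1+K (i , i≤R , b≡gen) p@(⟨⟩-add _ (⟨⟩-add _ _)) with sum-shape p
  ... | A , s≤A , b≡KA+s =
    ⊥-elim (gen≢long-sum (≤-trans (^-monoʳ-≤ 2 i≤R) 2^R≤1+K) (s≤s (s≤s z≤n)) s≤A
      (trans (sym b≡gen) b≡KA+s))

  genFin : Fin (R + 1) → ℕ
  genFin j = gen (toℕ j)

  G≐Image-genFin : G ≐ Image genFin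
  G≐Image-genFin =
    (λ (i , i≤R , x≡gen) → fromℕ< (i<R+1 i≤R) , trans (cong gen (toℕ-fromℕ< (i<R+1 i≤R))) (sym x≡gen)) ,
    (λ (j , genFin≡x) → toℕ j , m<1+n⇒m≤n (subst (toℕ j <_) (+-comm R 1) (toℕ<n j)) , sym genFin≡x)
    where
    i<R+1 : ∀ {i} → i ≤ R → i < R + 1
    i<R+1 {i} i≤R = subst (i <_) (+-comm 1 R) (s≤s i≤R)

  genFin-injective : 0 < K → Injective _≡_ _≡_ genFin
  genFin-injective 0<K genFin≡ = toℕ-injective (^-injectiveʳ 2 ≤-refl
    (*-cancelˡ-≡ _ _ K {{>-nonZero 0<K}} (+-cancelʳ-≡ 1 _ _ genFin≡)))

module _ (k n r : ℕ) where
  open PowerGenerators (k * 2 ^ n) (n + r)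

  k*2^[n+i]≡gen : ∀ i → k * 2 ^ (n + i) + 1 ≡ gen i
  k*2^[n+i]≡gen i =
    cong (_+ 1) (trans (cong (k *_) (^-distribˡ-+-* 2 n i)) (sym (*-assoc k (2 ^ n) (2 ^ i))))

  G≐B-gen : G ≐ B-gen k n r
  G≐B-gen =
    (λ (i , i≤R , x≡gen) → i , i≤R , trans x≡gen (sym (k*2^[n+i]≡gen i))) ,
    (λ (i , i≤R , x≡) → i , i≤R , trans x≡ (k*2^[n+i]≡gen i))

  G-generates-P : n + r ≤ k * 2 ^ n → suc (k * 2 ^ n) < 2 ^ suc (n + r) → Generates G (P k n)
  G-generates-P R≤K 1+K<2^[1+R] =
    ⟨⟩-mono (λ (i , _ , x≡gen) → i , trans x≡gen (sym (k*2^[n+i]≡gen i))) ,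
    ⟨⟩-least (λ (i , x≡) → subst ⟨ G ⟩ (sym (trans x≡ (k*2^[n+i]≡gen i))) (gen∈⟨G⟩ R≤K 1+K<2^[1+R] i))

  2^[n+r]≤k*2^n : 2 ^ r ≤ k → 2 ^ (n + r) ≤ k * 2 ^ n
  2^[n+r]≤k*2^n 2^r≤k = begin
    2 ^ (n + r)    ≡⟨ ^-distribˡ-+-* 2 n r ⟩
    2 ^ n * 2 ^ r  ≡⟨ *-comm (2 ^ n) (2 ^ r) ⟩
    2 ^ r * 2 ^ n  ≤⟨ *-monoˡ-≤ (2 ^ n) 2^r≤k ⟩
    k * 2 ^ n      ∎
    where open ≤-Reasoning

  1+k*2^n<2^[1+n+r] : 0 < n → k < 2 ^ (r + 1) → suc (k * 2 ^ n) < 2 ^ suc (n + r)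
  1+k*2^n<2^[1+n+r] 0<n k<2^[r+1] = begin
    2 + k * 2 ^ n        ≤⟨ +-monoˡ-≤ (k * 2 ^ n) (^-monoʳ-≤ 2 0<n) ⟩
    suc k * 2 ^ n        ≤⟨ *-monoˡ-≤ (2 ^ n) k<2^[r+1] ⟩
    2 ^ (r + 1) * 2 ^ n  ≡⟨ ^-distribˡ-+-* 2 (r + 1) n ⟨
    2 ^ (r + 1 + n)      ≡⟨ cong (2 ^_) (identity r n) ⟩
    2 ^ suc (n + r)      ∎
    where
    open ≤-Reasoning
    identity : ∀ r n → r + 1 + n ≡ suc (n + r)
    identity = solve-∀

theorem4 : (n k r : ℕ) → 2 < n → k % 2 ≡ 1 → 1 < k → k < 2 ^ n
    → 2 ^ r < k → k < 2 ^ (r + 1)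
    → IsMinimalSystemOfGenerators (B-gen k n r) (P k n)
      × EmbeddingDimension (P k n) (n + r + 1)
theorem4 n k r 2<n _ _ _ 2^r<k k<2^[r+1] =
  IsMinimalSystemOfGenerators-resp-≐ (G≐B-gen k n r) minimal ,
  genFin , genFin-injective 0<K , IsMinimalSystemOfGenerators-resp-≐ G≐Image-genFin minimal
  where
  open PowerGenerators (k * 2 ^ n) (n + r)
  2^R≤K : 2 ^ (n + r) ≤ k * 2 ^ n
  2^R≤K = 2^[n+r]≤k*2^n k n r (<⇒≤ 2^r<k)
  0<K : 0 < k * 2 ^ n
  0<K = ≤-trans (m^n>0 2 (n + r)) 2^R≤K
  minimal : IsMinimalSystemOfGenerators G (P k n)
  minimal = irreducible⇒minimal
    (G-generates-P k n r (<⇒≤ (<-≤-trans (n<2^n (n + r)) 2^R≤K))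
      (1+k*2^n<2^[1+n+r] k n r (≤-trans (s≤s z≤n) 2<n) k<2^[r+1]))
    (G-irreducible (m≤n⇒m≤1+n 2^R≤K))
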